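{- Let $n\geq1$ and consider the normed BPA system $\Delta_0$ described in the context. Let $b_1,\dots,b_n\in\{0,1\}$, let $\alpha\in\mathrm{Enc}(b_nb_{n-1}\dots b_1)$ and let $\beta$ be a process with $\mathrm{Var}(\beta)\subseteq\{Z_1^0,Z_1^1,\dots,Z_n^0,Z_n^1\}$. Then (1) $\beta\alpha\simeq\alpha$ if and only if $\mathrm{Var}(\beta)\subseteq\{Z_1^{b_1},\dots,Z_n^{b_n}\}$; and (2) $\beta\alpha\approx\alpha$ if and only if $\mathrm{Var}(\beta)\subseteq\{Z_1^{b_1},\dots,Z_n^{b_n}\}$.
   Context: BPA systems: a BPA system $(\mathcal{V},\mathcal{A},\mathcal{R})$ has finite sets of variables, actions (containing the internal action $\tau$) and rules $X\xrightarrow{\lambda}\alpha$; processes are words over $\mathcal{V}$; if $X\xrightarrow{\lambda}\alpha$ is a rule then $X\beta\xrightarrow{\lambda}\alpha\beta$. Write $\to$ for $\xrightarrow{\tau}$, $\Rightarrow$ for its reflexive transitive closure, $\mathrm{Var}(\alpha)$ for the set of variables occurring in $\alpha$. A symmetric relation $R$ is a branching bisimulation if whenever $\alpha R\beta$ and $\alpha\xrightarrow{\lambda}\alpha'$, either ($\lambda=\tau$ and $\alpha'R\beta$) or $\beta\Rightarrow\beta''\xrightarrow{\lambda}\beta'$ with $\alpha R\beta''$ and $\alpha'R\beta'$; it is a weak bisimulation if whenever $\alpha R\beta$ and $\alpha\xrightarrow{\lambda}\alpha'$, either ($\lambda=\tau$ and $\alpha'R\beta$) or $\beta\Rightarrow\gamma_1\xrightarrow{\lambda}\gamma_2\Rightarrow\beta'$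 with $\alpha'R\beta'$. $\simeq$ and $\approx$ are the largest branching and weak bisimulations. The system $\Delta_0$: variables $\mathcal{B}\uplus\mathcal{B}'$ with $\mathcal{B}=\{B_i^0,B_i^1\mid 1\le i\le n\}$ and $\mathcal{B}'=\{Z_i^0,Z_i^1\mid 1\le i\le n\}\cup\{B_i^b(j,b')\mid 1\le i,j\le n,\ i\ne j,\ b,b'\in\{0,1\}\}$; actions $\{d,\tau\}\cup\{a_i^0,a_i^1\mid 1\le i\le n\}$; rules, for all $1\le i,j,j'\le n$ and $b,b',b''\in\{0,1\}$: $Z_i^b\xrightarrow{a_i^b}\epsilon$, $Z_i^b\xrightarrow{\tau}\epsilon$; $B_i^b\xrightarrow{a_i^b}B_i^b$, $B_i^b\xrightarrow{d}\epsilon$, $B_i^b\xrightarrow{a_j^{b'}}B_i^b(j,b')$ for $j\ne i$; $B_i^b(j,b')\xrightarrow{a_i^b}B_i^b(j,b')$, $B_i^b(j,b')\xrightarrow{d}Z_j^{b'}$, $B_i^b(j,b')\xrightarrow{a_{j'}^{b''}}B_i^b(j',b'')$ for $j\ne i$, $j'\ne i$. Encoding: $\alpha\in\mathrm{Enc}(b_nb_{n-1}\dots b_1)$ means $\mathrm{Var}(\alpha)\subseteq\mathcal{B}$ and for every $1\le i\le n$ there are processes $\alpha_{i_1},\alpha_{i_2}$ with $\alpha=\alpha_{i_1}B_i^{b_i}\alpha_{i_2}$ and $B_i^{1-b_i}\notin\mathrm{Var}(\alpha_{i_1})$. -}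

module Defs where

open import Data.Nat using (ℕ)
open import Data.Fin using (Fin)
open import Data.Bool using (Bool; not)
open import Data.List using (List; []; _∷_; _++_)
open import Data.List.Relation.Unary.All using (All)
open import Data.List.Membership.Propositional using (_∉_)
open import Data.Product using (Σ; ∃; ∃-syntax; _×_; _,_)
open import Data.Sum using (_⊎_)
open import Relation.Binary.PropositionalEquality using (_≡_; _≢_)
open import Relation.Binary.Construct.Closure.ReflexiveTransitive using (Star)

-- Variables of Δ₀ (indices 1..n rendered as Fin n = 0..n-1)
--   B i b        is B_i^b
--   Z i b        is Z_i^b
--   Bj i b j _ b' is B_i^b(j,b')   (only for i ≠ j; proof is irrelevant)
data Var (n : ℕ) : Set where
  B  : Fin n → Bool → Var n
  Z  : Fin n → Bool → Var n
  Bj : (i : Fin n) → Bool → (j : Fin n) → .(i ≢ j) → Bool → Var n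

data Act (n : ℕ) : Set where
  τ : Act n
  d : Act n
  a : Fin n → Bool → Act n

Proc : ℕ → Set
Proc n = List (Var n)

data Rule {n : ℕ} : Var n → Act n → Proc n → Set where
  Z-a   : ∀ i b → Rule (Z i b) (a i b) []
  Z-τ   : ∀ i b → Rule (Z i b) τ []
  B-a   : ∀ i b → Rule (B i b) (a i b) (B i b ∷ [])
  B-d   : ∀ i b → Rule (B i b) d []
  B-aj  : ∀ i b j b' → (p : i ≢ j) → Rule (B i b) (a j b') (Bj i b j p b' ∷ [])
  Bj-a  : ∀ i b j b' → .(p : i ≢ j) → Rule (Bj i b j p b') (a i b) (Bj i b j p b' ∷ [])
  Bj-d  : ∀ i b j b' → .(p : i ≢ j) → Rule (Bj i b j p b') d (Z j b' ∷ [])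
  Bj-aj : ∀ i b j b' j' b'' → .(p : i ≢ j) → (q : i ≢ j') →
          Rule (Bj i b j p b') (a j' b'') (Bj i b j' q b'' ∷ [])

data Step {n : ℕ} : Proc n → Act n → Proc n → Set where
  step : ∀ {X l α} (β : Proc n) → Rule X l α → Step (X ∷ β) l (α ++ β)

_⇒_ : ∀ {n} → Proc n → Proc n → Set
_⇒_ {n} = Star (λ x y → Step {n} x τ y)

Relation : ℕ → Set₁
Relation n = Proc n → Proc n → Set

Symmetric : ∀ {n} → Relation n → Set
Symmetric R = ∀ {x y} → R x y → R y x

IsBranchingBisim : ∀ {n} → Relation n → Set
IsBranchingBisim {n} R =
  Symmetric R ×
  (∀ {α β α' : Proc n} {l : Act n} → R α β → Step α l α' →
     (l ≡ τ × R α' β) ⊎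
     (∃[ β'' ] ∃[ β' ] (β ⇒ β'') × Step β'' l β' × R α β'' × R α' β'))

IsWeakBisim : ∀ {n} → Relation n → Set
IsWeakBisim {n} R =
  Symmetric R ×
  (∀ {α β α' : Proc n} {l : Act n} → R α β → Step α l α' →
     (l ≡ τ × R α' β) ⊎
     (∃[ γ₁ ] ∃[ γ₂ ] ∃[ β' ] (β ⇒ γ₁) × Step γ₁ l γ₂ × (γ₂ ⇒ β') × R α' β'))

_≃b_ : ∀ {n} → Proc n → Proc n → Set₁
_≃b_ {n} x y = Σ (Relation n) λ R → IsBranchingBisim R × R x y

_≈w_ : ∀ {n} → Proc n → Proc n → Set₁
_≈w_ {n} x y = Σ (Relation n) λ R → IsWeakBisim R × R x y

IsB : ∀ {n} → Var n → Set
IsB {n} X = ∃[ i ] ∃[ b ] X ≡ B {n} i b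

IsZ : ∀ {n} → Var n → Set
IsZ {n} X = ∃[ i ] ∃[ b ] X ≡ Z {n} i b

IsZb : ∀ {n} → (Fin n → Bool) → Var n → Set
IsZb {n} bs X = ∃[ i ] X ≡ Z {n} i (bs i)

Enc : ∀ {n} → (Fin n → Bool) → Proc n → Set
Enc {n} bs α =
  All IsB α ×
  (∀ (i : Fin n) → ∃[ α₁ ] ∃[ α₂ ]
     (α ≡ α₁ ++ (B i (bs i) ∷ α₂)) × (B i (not (bs i)) ∉ α₁))

module Submission where

-- The bit of α at position i is read off as the index of the first
-- B_i-variable of α (the relation Encodes).  Since branching bisimilarity
-- implies weak bisimilarity, two directions suffice.
--
-- If: an explicit branching bisimulation (Rel) relates γ δ to δ whenever
-- the Z-word γ agrees with the bits of δ; Z_i^c then matches its a_i^c-move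
-- either by the loop B_i^c → B_i^c or by moving B_k^e to the "delayed"
-- variable B_k^e(i,c), whose d-move yields the harmless Z_i^c.
--
-- Only if: B-words and B_k^e(j,c)-headed words have no τ-steps, so they
-- answer visible moves strongly.  If Z_i^{¬b} is followed by δ encoding b
-- at i, then δ must answer a_i^{¬b} by moving its head B_k^e (k ≠ i) to
-- B_k^e(i,¬b); answering the subsequent d reduces to the same situation
-- on the tail of δ.  The recursion ends at the first B_i-variable of δ,
-- which is B_i^b and cannot perform a_i^{¬b} at all.

open import Defs
open import Data.Nat using (ℕ; _≤_)
open import Data.Fin using (Fin)
open import Data.Fin.Properties using () renaming (_≟_ to _≟F_)
open import Data.Bool using (Bool; true; false; not)
open import Data.Bool.Properties using (¬-not) renaming (_≟_ to _≟B_)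
open import Data.List using ([]; _∷_; _++_)
open import Data.List.Relation.Unary.All using (All; []; _∷_)
open import Data.List.Relation.Unary.All.Properties using (++⁻ˡ)
open import Data.List.Membership.Propositional using (_∉_)
open import Data.List.Relation.Unary.Any using (here; there)
open import Data.Product using (_×_; _,_; Σ; ∃-syntax; proj₁; proj₂)
open import Data.Sum using (_⊎_; inj₁; inj₂; map₂)
open import Data.Empty using (⊥-elim)
open import Function using (_∘_)
open import Function.Bundles using (_⇔_; mk⇔)
open import Relation.Binary.PropositionalEquality using (_≡_; refl; sym; cong; subst; _≢_)
open import Relation.Binary.Construct.Closure.ReflexiveTransitive using (ε; _◅_)
open import Relation.Nullary using (¬_; yes; no)

_=[_]⇒_ : ∀ {n} → Proc n → Act n → Proc n → Set
β =[ l ]⇒ β' = ∃[ γ₁ ] ∃[ γ₂ ] (β ⇒ γ₁) × Step γ₁ l γ₂ × (γ₂ ⇒ β')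

weak-match : ∀ {n} {R : Relation n} → IsWeakBisim R →
  ∀ {α β α' l} → R α β → Step α l α' → l ≢ τ → ∃[ β' ] (β =[ l ]⇒ β') × R α' β'
weak-match (_ , bisim) r s l≢τ with bisim r s
... | inj₁ (l≡τ , _) = ⊥-elim (l≢τ l≡τ)
... | inj₂ (γ₁ , γ₂ , β' , τs , s' , τs' , r') = β' , (γ₁ , γ₂ , τs , s' , τs') , r'

branching⇒weak-bisim : ∀ {n} {R : Relation n} → IsBranchingBisim R → IsWeakBisim R
branching⇒weak-bisim (sym-R , bisim) =
  sym-R , λ r s → map₂ (λ { (β'' , β' , τs , s' , _ , r') → β'' , β' , β' , τs , s' , ε , r' })
                      (bisim r s)

≃b⇒≈w : ∀ {n} {α β : Proc n} → α ≃b β → α ≈w β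
≃b⇒≈w (R , bb , r) = R , branching⇒weak-bisim bb , r

Stable : ∀ {n} → Proc n → Set
Stable α = ∀ {α'} → ¬ Step α τ α'

stable-⇒ : ∀ {n} {α α' : Proc n} → Stable α → α ⇒ α' → α' ≡ α
stable-⇒ _      ε       = refl
stable-⇒ stable (s ◅ _) = ⊥-elim (stable s)

stable-no-τ-⇒ : ∀ {n} {α γ γ' : Proc n} → Stable α → α ⇒ γ → ¬ Step γ τ γ'
stable-no-τ-⇒ stable ε       s = stable s
stable-no-τ-⇒ stable (s ◅ _) _ = stable s

B-word-stable : ∀ {n} {δ : Proc n} → All IsB δ → Stable δ
B-word-stable ((_ , _ , refl) ∷ _) (step _ ())

Bj-stable : ∀ {n} {k j : Fin n} {e c} .{p : k ≢ j} {δ : Proc n} → Stable (Bj k e j p c ∷ δ)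
Bj-stable (step _ ())

data Encodes {n} (i : Fin n) (c : Bool) : Proc n → Set where
  first : ∀ {δ} → Encodes i c (B i c ∷ δ)
  skip  : ∀ {k e δ} → k ≢ i → Encodes i c δ → Encodes i c (B k e ∷ δ)

encodes-after : ∀ {n} {i : Fin n} {b} {α₁ α₂ : Proc n} → All IsB α₁ → B i (not b) ∉ α₁ →
  Encodes i b (α₁ ++ B i b ∷ α₂)
encodes-after [] _ = first
encodes-after {i = i} {b} ((k , e , refl) ∷ all-B) b̄∉ with k ≟F i | e ≟B b
... | no k≢i  | _       = skip k≢i (encodes-after all-B (b̄∉ ∘ there))
... | yes refl | yes refl = first
... | yes refl | no e≢b  = ⊥-elim (b̄∉ (here (cong (B k) (sym (¬-not e≢b)))))

Enc⇒Encodes : ∀ {n} (bs : Fin n → Bool) {α : Proc n} → Enc bs α → ∀ i → Encodes i (bs i) α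
Enc⇒Encodes bs (all-B , split) i with split i
... | α₁ , _ , refl , b̄∉α₁ = encodes-after (++⁻ˡ α₁ all-B) b̄∉α₁

data Agrees {n} (δ : Proc n) : Proc n → Set where
  []  : Agrees δ []
  _∷_ : ∀ {i c γ} → Encodes i c δ → Agrees δ γ → Agrees δ (Z i c ∷ γ)

IsZb⇒Agrees : ∀ {n} (bs : Fin n → Bool) {α β : Proc n} → (∀ i → Encodes i (bs i) α) →
  All (IsZb bs) β → Agrees α β
IsZb⇒Agrees bs enc []                = []
IsZb⇒Agrees bs enc ((i , refl) ∷ zs) = enc i ∷ IsZb⇒Agrees bs enc zs

pop : ∀ {n} {δ γ : Proc n} → Agrees δ γ → (γ ++ δ) ⇒ δ
pop []                  = ε
pop (_∷_ {i} {c} _ agr) = step _ (Z-τ i c) ◅ pop agr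

-- Besides the identity and (symmetrically) "agreeing Z-prefix γ in front of
-- δ", the relation contains the intermediate states reached when γ B_k^e δ
-- answers an a_i^c-move (k ≠ i): then B_k^e δ turns into B_k^e(i,c) δ,
-- which behaves like B_k^e δ except that d leaves Z_i^c δ, harmless as δ
-- encodes c at i.
data Rel {n} : Proc n → Proc n → Set where
  same     : ∀ {α} → Rel α α
  popped   : ∀ {γ δ} → Agrees δ γ → Rel (γ ++ δ) δ
  popped˘  : ∀ {γ δ} → Agrees δ γ → Rel δ (γ ++ δ)
  delayed  : ∀ {γ k e δ i c} (p : k ≢ i) → Agrees (B k e ∷ δ) γ → Encodes i c δ →
             Rel (γ ++ B k e ∷ δ) (Bj k e i p c ∷ δ)
  delayed˘ : ∀ {γ k e δ i c} (p : k ≢ i) → Agrees (B k e ∷ δ) γ → Encodes i c δ →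
             Rel (Bj k e i p c ∷ δ) (γ ++ B k e ∷ δ)

Rel-symmetric : ∀ {n} → Symmetric (Rel {n})
Rel-symmetric same                = same
Rel-symmetric (popped agr)        = popped˘ agr
Rel-symmetric (popped˘ agr)       = popped agr
Rel-symmetric (delayed p agr enc)  = delayed˘ p agr enc
Rel-symmetric (delayed˘ p agr enc) = delayed p agr enc

-- A τ-step of a Z-prefix is absorbed; a visible step
-- of a Z-prefix is answered by its B-headed partner; the B-headed side is
-- answered after silently popping the Z-prefix of its partner.
Rel-transfer : ∀ {n} {α β α' : Proc n} {l : Act n} → Rel α β → Step α l α' →
  (l ≡ τ × Rel α' β) ⊎
  (∃[ β'' ] ∃[ β' ] (β ⇒ β'') × Step β'' l β' × Rel α β'' × Rel α' β')
Rel-transfer same s = inj₂ (_ , _ , ε , s , same , same)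
Rel-transfer (popped []) s = inj₂ (_ , _ , ε , s , same , same)
Rel-transfer (popped (_ ∷ agr)) (step _ (Z-τ i c)) = inj₁ (refl , popped agr)
Rel-transfer (popped (first ∷ agr)) (step _ (Z-a i c)) =
  inj₂ (_ , _ , ε , step _ (B-a i c) , popped (first ∷ agr) , popped agr)
Rel-transfer (popped (skip {k} {e} k≢i enc ∷ agr)) (step _ (Z-a i c)) =
  inj₂ (_ , _ , ε , step _ (B-aj k e i c k≢i) , popped (skip k≢i enc ∷ agr) , delayed k≢i agr enc)
Rel-transfer (popped˘ agr) s = inj₂ (_ , _ , pop agr , s , same , same)
Rel-transfer (delayed p (_ ∷ agr) enc) (step _ (Z-τ i c)) = inj₁ (refl , delayed p agr enc)
Rel-transfer (delayed {k = k} {e} {i = i} {c} p (first ∷ agr) enc) (step _ (Z-a _ _)) =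
  inj₂ (_ , _ , ε , step _ (Bj-a k e i c p) , delayed p (first ∷ agr) enc , delayed p agr enc)
Rel-transfer (delayed {k = k} {e} {i = i} {c} p (skip k≢j enc' ∷ agr) enc) (step _ (Z-a j c')) =
  inj₂ (_ , _ , ε , step _ (Bj-aj k e i c j c' p k≢j) ,
        delayed p (skip k≢j enc' ∷ agr) enc , delayed k≢j agr enc')
Rel-transfer (delayed {i = i} {c} p [] enc) (step _ (B-a k e)) =
  inj₂ (_ , _ , ε , step _ (Bj-a k e i c p) , delayed p [] enc , delayed p [] enc)
Rel-transfer (delayed {i = i} {c} p [] enc) (step _ (B-d k e)) =
  inj₂ (_ , _ , ε , step _ (Bj-d k e i c p) , delayed p [] enc , popped˘ (enc ∷ []))
Rel-transfer (delayed {i = i} {c} p [] enc) (step _ (B-aj k e j b k≢j)) =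
  inj₂ (_ , _ , ε , step _ (Bj-aj k e i c j b p k≢j) , delayed p [] enc , same)
Rel-transfer (delayed˘ p agr enc) (step _ (Bj-a k e i c _)) =
  inj₂ (_ , _ , pop agr , step _ (B-a k e) , delayed˘ p [] enc , delayed˘ p [] enc)
Rel-transfer (delayed˘ p agr enc) (step _ (Bj-d k e i c _)) =
  inj₂ (_ , _ , pop agr , step _ (B-d k e) , delayed˘ p [] enc , popped (enc ∷ []))
Rel-transfer (delayed˘ p agr enc) (step _ (Bj-aj k e i c j b _ k≢j)) =
  inj₂ (_ , _ , pop agr , step _ (B-aj k e j b k≢j) , delayed˘ p [] enc , same)

Rel-branching : ∀ {n} → IsBranchingBisim (Rel {n})
Rel-branching = Rel-symmetric , Rel-transfer

no-wrong-bit-step : ∀ {n} {i : Fin n} b {δ y} → ¬ Step (B i b ∷ δ) (a i (not b)) y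
no-wrong-bit-step true  (step _ (B-aj _ _ _ _ i≢i)) = i≢i refl
no-wrong-bit-step false (step _ (B-aj _ _ _ _ i≢i)) = i≢i refl

other-bit-step : ∀ {n} {k i : Fin n} {e c δ y} → k ≢ i → Step (B k e ∷ δ) (a i c) y →
  Σ (k ≢ i) λ p → y ≡ Bj k e i p c ∷ δ
other-bit-step k≢k (step _ (B-a _ _))          = ⊥-elim (k≢k refl)
other-bit-step _   (step _ (B-aj _ _ _ _ k≢i)) = k≢i , refl

Z-prefix-⇒ : ∀ {n} {k : Fin n} {e} {δ γ x : Proc n} → All IsZ γ → (γ ++ B k e ∷ δ) ⇒ x →
  ∃[ γ' ] All IsZ γ' × x ≡ γ' ++ B k e ∷ δ
Z-prefix-⇒ Zγ ε = _ , Zγ , refl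
Z-prefix-⇒ [] (step _ () ◅ _)
Z-prefix-⇒ ((_ , _ , refl) ∷ Zγ) (step _ (Z-τ _ _) ◅ τs) = Z-prefix-⇒ Zγ τs

d-step : ∀ {n} {k : Fin n} {e} {δ γ y : Proc n} → All IsZ γ → Step (γ ++ B k e ∷ δ) d y → y ≡ δ
d-step []                   (step _ (B-d _ _)) = refl
d-step ((_ , _ , refl) ∷ _) (step _ ())

weak-d : ∀ {n} {k : Fin n} {e} {δ γ z : Proc n} → All IsZ γ → All IsB δ →
  (γ ++ B k e ∷ δ) =[ d ]⇒ z → z ≡ δ
weak-d Zγ Bδ (_ , _ , τs , s , τs') with Z-prefix-⇒ Zγ τs
... | γ' , Zγ' , refl = stable-⇒ (B-word-stable Bδ) (subst (_⇒ _) (d-step Zγ' s) τs')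

-- Its a_i^{¬b}-move forces δ = B_k^e δ' (k ≠ i) to become B_k^e(i,¬b) δ';
-- answering that state's d-move, which leads to Z_i^{¬b} δ', returns
-- from γ B_k^e δ' to δ', so the claim recurs on δ'.
wrong-bit-not-bisimilar : ∀ {n} {R : Relation n} → IsWeakBisim R →
  ∀ {i b δ γ} → Encodes i b δ → All IsB δ → All IsZ γ → ¬ R (Z i (not b) ∷ γ ++ δ) δ
wrong-bit-not-bisimilar w {i} {b} enc Bδ Zγ r
  with weak-match w r (step _ (Z-a i (not b))) (λ ())
... | _ , (_ , _ , τs , s , τs') , r' with stable-⇒ (B-word-stable Bδ) τs | enc | Bδ
...   | refl | first | _ = no-wrong-bit-step b s
...   | refl | skip {k} {e} {δ'} k≢i enc' | _ ∷ Bδ' with other-bit-step k≢i s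
...     | p , refl with stable-⇒ Bj-stable τs'
...       | refl with weak-match w (proj₁ w r') (step δ' (Bj-d k e i (not b) p)) (λ ())
...         | _ , d-move , r'' with weak-d Zγ Bδ' d-move
...           | refl = wrong-bit-not-bisimilar w enc' Bδ' [] r''

-- Consequently a Z-word in front of α is weakly bisimilar to α only if it
-- agrees with the bits of α: a correct Z_i^{b_i} must be answered by the
-- stable α standing still, which reduces the claim to the rest of the word.
weak-bisim⇒IsZb : ∀ {n} {R : Relation n} (bs : Fin n → Bool) {α} → IsWeakBisim R → All IsB α →
  (∀ i → Encodes i (bs i) α) → ∀ {β} → All IsZ β → R (β ++ α) α → All (IsZb bs) β
weak-bisim⇒IsZb bs w Bα enc [] r = []
weak-bisim⇒IsZb {R = R} bs {α} w Bα enc (_∷_ {xs = β} (i , c , refl) Zβ) r with c ≟B bs i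
... | no c≢b = ⊥-elim (wrong-bit-not-bisimilar w (enc i) Bα Zβ
                 (subst (λ c → R (Z i c ∷ β ++ α) α) (¬-not c≢b) r))
... | yes refl with proj₂ w r (step _ (Z-τ i c))
...   | inj₁ (_ , r') = (i , refl) ∷ weak-bisim⇒IsZb bs w Bα enc Zβ r'
...   | inj₂ (_ , _ , _ , τs , s , _) = ⊥-elim (stable-no-τ-⇒ (B-word-stable Bα) τs s)

-- Lemma 14.
lemma14 : (n : ℕ) → 1 ≤ n → (bs : Fin n → Bool) → (α β : Proc n) →
    Enc bs α → All IsZ β →
    (((β ++ α) ≃b α) ⇔ All (IsZb bs) β) × (((β ++ α) ≈w α) ⇔ All (IsZb bs) β)
lemma14 n _ bs α β enc Zβ =
  mk⇔ (only-if ∘ ≃b⇒≈w) if , mk⇔ only-if (≃b⇒≈w ∘ if)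
  where
  bits : ∀ i → Encodes i (bs i) α
  bits = Enc⇒Encodes bs enc

  only-if : (β ++ α) ≈w α → All (IsZb bs) β
  only-if (R , w , r) = weak-bisim⇒IsZb bs w (proj₁ enc) bits Zβ r

  if : All (IsZb bs) β → (β ++ α) ≃b α
  if Zbβ = Rel , Rel-branching , popped (IsZb⇒Agrees bs bits Zbβ)
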